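{- Let $T\in\mathcal{T}_{t,n-t}$, where $t\le 2k-2$, $2\le t\le n-2$, and $k\ge 2$. Then $\mu(T) < k+\frac12$.
   Context: For integers $a\ge2$, $b\ge1$, $\mathcal{T}_{a,b}$ is the set of trees of order $a+b$ obtained from a tree $H$ of order $a$ by attaching $b$ pendent vertices (new vertices of degree 1) to some vertices of $H$. For a connected graph $H$ on $n$ vertices, the average distance is $\mu(H)=\binom{n}{2}^{ -1}\sum_{\{u,v\}\subset V(H)} d_H(u,v)$, where $d_H$ is the distance in $H$. -}

module Defs where

open import Data.Nat using (ℕ; zero; suc; _+_; _*_; _∸_; _≤_; _<_)
open import Data.Fin using (Fin; toℕ)
import Data.Fin as F
open import Data.Sum using (_⊎_; inj₁; inj₂)
open import Data.Product using (Σ; _×_)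
open import Data.Empty using (⊥)
open import Relation.Binary.PropositionalEquality using (_≡_)

-- A tree of order t on the vertex set Fin t, given by a parent array:
-- vertex 0 is the root, and every other vertex i has a parent of
-- strictly smaller index.  Every (unlabelled) tree of order t ≥ 1 arises
-- this way (label vertices in BFS order), and every parent array yields a tree.
record Tree (t : ℕ) : Set where
  field
    parent   : (i : Fin t) → 0 < toℕ i → Fin t
    parent-< : (i : Fin t) (h : 0 < toℕ i) → toℕ (parent i h) < toℕ i

open Tree public

TreeAdj : {t : ℕ} → Tree t → Fin t → Fin t → Set
TreeAdj H u v = (Σ (0 < toℕ u) λ h → parent H u h ≡ v)
              ⊎ (Σ (0 < toℕ v) λ h → parent H v h ≡ u)

-- The tree obtained from H (order t) by attaching b pendent vertices:
-- vertex set Fin t ⊎ Fin b, new vertex inj₂ j is attached to H-vertex att j.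
AttachAdj : {t b : ℕ} → Tree t → (Fin b → Fin t) →
            Fin t ⊎ Fin b → Fin t ⊎ Fin b → Set
AttachAdj H att (inj₁ u) (inj₁ v) = TreeAdj H u v
AttachAdj H att (inj₁ u) (inj₂ j) = att j ≡ u
AttachAdj H att (inj₂ j) (inj₁ u) = att j ≡ u
AttachAdj H att (inj₂ i) (inj₂ j) = ⊥

data Walk {V : Set} (Adj : V → V → Set) : V → V → ℕ → Set where
  here : (u : V) → Walk Adj u u 0
  step : {u v w : V} {m : ℕ} → Adj u v → Walk Adj v w m → Walk Adj u w (suc m)

IsDistance : {V : Set} (Adj : V → V → Set) → V → V → ℕ → Set
IsDistance Adj u v m = Walk Adj u v m × ((m' : ℕ) → Walk Adj u v m' → m ≤ m')

ΣFin : (n : ℕ) → (Fin n → ℕ) → ℕ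
ΣFin zero f = 0
ΣFin (suc n) f = f F.zero + ΣFin n (λ i → f (F.suc i))

ΣV : (t b : ℕ) → (Fin t ⊎ Fin b → ℕ) → ℕ
ΣV t b f = ΣFin t (λ i → f (inj₁ i)) + ΣFin b (λ j → f (inj₂ j))

-- sum of d(u,v) over ORDERED pairs (u,v); equals twice the Wiener index
-- (sum over unordered pairs {u,v}), since d(u,u) = 0.
OrderedDistSum : (t b : ℕ) → (Fin t ⊎ Fin b → Fin t ⊎ Fin b → ℕ) → ℕ
OrderedDistSum t b d = ΣV t b (λ u → ΣV t b (λ v → d u v))

-- Replacing every pendant vertex by its neighbour in H changes a distance by
-- at most the number of pendant endpoints, so the ordered distance sum of T is
-- at most that of the resulting multiset of n points of H plus 2bn, where
-- b = n - t.  For a multiset of m points in a tree of order a the ordered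
-- distance sum is at most (a - 1) m² / 2: moving every point at the vertex of
-- largest index (a leaf, since parents have smaller indices) to its parent
-- changes only the distances between the A moved and the B remaining points,
-- each by at most one, and 2 (AB + BA) ≤ (A + B)² = m².  Hence twice the
-- ordered distance sum of T is at most (t - 1) n² + 4bn, which is smaller than
-- (t + 3) n (n - 1) ≤ (2k + 1) n (n - 1) as soon as t ≥ 2.

{-# OPTIONS --safe #-}
module Submission where

open import Defs
open import Data.Nat using (ℕ; zero; suc; pred; _+_; _*_; _∸_; _≤_; _<_; z≤n; s≤s; s≤s⁻¹; z<s)
open import Data.Nat.Properties
open import Data.Nat.Combinatorics using (_C_; nC1≡n; nCk+nC[k+1]≡[n+1]C[k+1])
open import Data.Nat.Tactic.RingSolver using (solve-∀)
open import Data.Fin using (Fin; toℕ; splitAt) renaming (zero to fz; suc to fs)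
open import Data.Fin.Properties using (toℕ-injective; toℕ<n)
open import Data.Sum using (_⊎_; inj₁; inj₂; map₁; [_,_]′)
open import Data.Product using (_,_; proj₁; proj₂)
open import Function using (_∘_)
open import Relation.Binary.PropositionalEquality
open import Relation.Nullary using (yes; no)
open import Algebra.Properties.CommutativeSemigroup *-commutativeSemigroup using (x∙yz≈y∙xz)
open import Algebra.Properties.Semiring.Sum +-*-semiring
  using (sum; sum-syntax; sum-cong-≗; sum-replicate-zero; ∑-distrib-+;
         *-distribˡ-sum; *-distribʳ-sum)


_++ʷ_ : ∀ {V : Set} {Adj : V → V → Set} {u v w l l′} →
        Walk Adj u v l → Walk Adj v w l′ → Walk Adj u w (l + l′)
here _   ++ʷ q = q
step a p ++ʷ q = step a (p ++ʷ q)

module Distance {V : Set} {Adj : V → V → Set} (d : V → V → ℕ)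
                (isDistance : ∀ u v → IsDistance Adj u v (d u v)) where

  d[u,u]≡0 : ∀ u → d u u ≡ 0
  d[u,u]≡0 u = n≤0⇒n≡0 (proj₂ (isDistance u u) 0 (here u))

  triangle : ∀ u v w → d u w ≤ d u v + d v w
  triangle u v w = proj₂ (isDistance u w) _ (proj₁ (isDistance u v) ++ʷ proj₁ (isDistance v w))

  adjacent⇒d≤1 : ∀ {u v} → Adj u v → d u v ≤ 1
  adjacent⇒d≤1 {v = v} uv = proj₂ (isDistance _ v) 1 (step uv (here v))

  adjacentˡ : ∀ {u v} → Adj u v → ∀ w → d u w ≤ suc (d v w)
  adjacentˡ {u} {v} uv w = ≤-trans (triangle u v w) (+-monoˡ-≤ (d v w) (adjacent⇒d≤1 uv))

  adjacentʳ : ∀ {v w} → Adj v w → ∀ u → d u w ≤ suc (d u v)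
  adjacentʳ {v} {w} vw u = begin
    d u w         ≤⟨ triangle u v w ⟩
    d u v + d v w ≤⟨ +-monoʳ-≤ (d u v) (adjacent⇒d≤1 vw) ⟩
    d u v + 1     ≡⟨ +-comm (d u v) 1 ⟩
    suc (d u v)   ∎
    where open ≤-Reasoning

ΣFin≡sum : ∀ n (f : Fin n → ℕ) → ΣFin n f ≡ sum f
ΣFin≡sum zero    f = refl
ΣFin≡sum (suc n) f = cong (f fz +_) (ΣFin≡sum n (f ∘ fs))

sum-splitAt : ∀ m {n} (f : Fin m ⊎ Fin n → ℕ) →
              sum (f ∘ splitAt m) ≡ sum (f ∘ inj₁) + sum (f ∘ inj₂)
sum-splitAt zero    f = refl
sum-splitAt (suc m) f = trans (cong (f (inj₁ fz) +_) (sum-splitAt m (f ∘ map₁ fs)))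
                              (sym (+-assoc (f (inj₁ fz)) _ _))

ΣV≡sum : ∀ t b (f : Fin t ⊎ Fin b → ℕ) → ΣV t b f ≡ sum (f ∘ splitAt t)
ΣV≡sum t b f = trans (cong₂ _+_ (ΣFin≡sum t (f ∘ inj₁)) (ΣFin≡sum b (f ∘ inj₂)))
                     (sym (sum-splitAt t f))

OrderedDistSum≡∑∑ : ∀ t b (d : Fin t ⊎ Fin b → Fin t ⊎ Fin b → ℕ) →
  OrderedDistSum t b d ≡ ∑[ i < t + b ] ∑[ j < t + b ] d (splitAt t i) (splitAt t j)
OrderedDistSum≡∑∑ t b d =
  trans (ΣV≡sum t b (λ u → ΣV t b (d u))) (sum-cong-≗ (λ i → ΣV≡sum t b (d (splitAt t i))))

sum-mono-≤ : ∀ {n} {f g : Fin n → ℕ} → (∀ i → f i ≤ g i) → sum f ≤ sum g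
sum-mono-≤ {zero}  f≤g = z≤n
sum-mono-≤ {suc n} f≤g = +-mono-≤ (f≤g fz) (sum-mono-≤ (f≤g ∘ fs))

sum-const : ∀ n x → ∑[ i < n ] x ≡ n * x
sum-const zero    x = refl
sum-const (suc n) x = cong (x +_) (sum-const n x)

∑∑-mono-≤ : ∀ {m n} {F G : Fin m → Fin n → ℕ} → (∀ i j → F i j ≤ G i j) →
            ∑[ i < m ] ∑[ j < n ] F i j ≤ ∑[ i < m ] ∑[ j < n ] G i j
∑∑-mono-≤ F≤G = sum-mono-≤ (λ i → sum-mono-≤ (F≤G i))

∑∑-distrib-+ : ∀ {m n} (F G : Fin m → Fin n → ℕ) →
               ∑[ i < m ] ∑[ j < n ] (F i j + G i j)
                 ≡ ∑[ i < m ] ∑[ j < n ] F i j + ∑[ i < m ] ∑[ j < n ] G i j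
∑∑-distrib-+ F G = trans (sum-cong-≗ (λ i → ∑-distrib-+ (F i) (G i)))
                         (∑-distrib-+ (λ i → sum (F i)) (λ i → sum (G i)))

∑∑-product : ∀ {m n} (f : Fin m → ℕ) (g : Fin n → ℕ) →
             ∑[ i < m ] ∑[ j < n ] (f i * g j) ≡ sum f * sum g
∑∑-product f g = begin
  ∑[ i < _ ] ∑[ j < _ ] (f i * g j) ≡⟨ sum-cong-≗ (λ i → *-distribˡ-sum (f i) g) ⟨
  ∑[ i < _ ] (f i * sum g)          ≡⟨ *-distribʳ-sum (sum g) f ⟨
  sum f * sum g                     ∎
  where open ≡-Reasoning

∑∑-separable : ∀ {m n} (f : Fin m → ℕ) (g : Fin n → ℕ) →
               ∑[ i < m ] ∑[ j < n ] (f i + g j) ≡ n * sum f + m * sum g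
∑∑-separable {m} {n} f g = begin
  ∑[ i < m ] ∑[ j < n ] (f i + g j) ≡⟨ sum-cong-≗ (λ i → ∑-distrib-+ (λ _ → f i) g) ⟩
  ∑[ i < m ] (∑[ j < n ] f i + sum g) ≡⟨ sum-cong-≗ (λ i → cong (_+ sum g) (sum-const n (f i))) ⟩
  ∑[ i < m ] (n * f i + sum g)      ≡⟨ ∑-distrib-+ (λ i → n * f i) (λ _ → sum g) ⟩
  ∑[ i < m ] (n * f i) + ∑[ i < m ] sum g ≡⟨ cong₂ _+_ (sym (*-distribˡ-sum n f)) (sum-const m (sum g)) ⟩
  n * sum f + m * sum g             ∎
  where open ≡-Reasoning

2*[m*n+n*m]≤[m+n]*[m+n] : ∀ m n → 2 * (m * n + n * m) ≤ (m + n) * (m + n)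
2*[m*n+n*m]≤[m+n]*[m+n] m n = [ ordered , swapped ]′ (≤-total m n)
  where
  square : ∀ a o → 2 * (a * (a + o) + (a + o) * a) + o * o ≡ (a + (a + o)) * (a + (a + o))
  square = solve-∀
  ordered : ∀ {a b} → a ≤ b → 2 * (a * b + b * a) ≤ (a + b) * (a + b)
  ordered {a} a≤b with m≤n⇒∃[o]m+o≡n a≤b
  ... | o , refl = subst (2 * (a * (a + o) + (a + o) * a) ≤_) (square a o) (m≤m+n _ (o * o))
  swapped : n ≤ m → 2 * (m * n + n * m) ≤ (m + n) * (m + n)
  swapped n≤m = subst₂ _≤_ (cong (2 *_) (+-comm (n * m) (m * n))) (cong (λ x → x * x) (+-comm n m))
                       (ordered n≤m)

module PairDistanceSum {t : ℕ} (H : Tree t) (D : Fin t → Fin t → ℕ)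
  (D[x,x]≡0 : ∀ x → D x x ≡ 0)
  (D-parentˡ : ∀ x (x>0 : 0 < toℕ x) y → D x y ≤ suc (D (parent H x x>0) y))
  (D-parentʳ : ∀ x (x>0 : 0 < toℕ x) y → D y x ≤ suc (D y (parent H x x>0)))
  where

  pairDistSum : ∀ {m} → (Fin m → Fin t) → ℕ
  pairDistSum {m} g = ∑[ i < m ] ∑[ j < m ] D (g i) (g j)

  private
    positive : ∀ {x : Fin t} {s} → toℕ x ≡ suc s → 0 < toℕ x
    positive x≡1+s = subst (0 <_) (sym x≡1+s) z<s

  lower : ℕ → Fin t → Fin t
  lower s x with toℕ x ≟ suc s
  ... | yes x≡1+s = parent H x (positive x≡1+s)
  ... | no  _     = x

  moved stays : ℕ → Fin t → ℕ
  moved s x with toℕ x ≟ suc s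
  ... | yes _ = 1
  ... | no  _ = 0
  stays s x with toℕ x ≟ suc s
  ... | yes _ = 0
  ... | no  _ = 1

  moved+stays≡1 : ∀ s x → moved s x + stays s x ≡ 1
  moved+stays≡1 s x with toℕ x ≟ suc s
  ... | yes _ = refl
  ... | no  _ = refl

  toℕ-lower : ∀ s x → toℕ x ≤ suc s → toℕ (lower s x) ≤ s
  toℕ-lower s x x≤1+s with toℕ x ≟ suc s
  ... | yes x≡1+s = s≤s⁻¹ (<-≤-trans (parent-< H x (positive x≡1+s)) (≤-reflexive x≡1+s))
  ... | no  x≢1+s = s≤s⁻¹ (≤∧≢⇒< x≤1+s x≢1+s)

  D-lower : ∀ s x y →
    D x y ≤ (moved s x * stays s y + stays s x * moved s y) + D (lower s x) (lower s y)
  D-lower s x y with toℕ x ≟ suc s | toℕ y ≟ suc s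
  ... | yes x≡1+s | yes y≡1+s = ≤-trans (≤-reflexive D[x,y]≡0) z≤n
    where
    D[x,y]≡0 : D x y ≡ 0
    D[x,y]≡0 = trans (cong (D x) (toℕ-injective (trans y≡1+s (sym x≡1+s)))) (D[x,x]≡0 x)
  ... | yes x≡1+s | no  _     = D-parentˡ x (positive x≡1+s) y
  ... | no  _     | yes y≡1+s = D-parentʳ y (positive y≡1+s) x
  ... | no  _     | no  _     = ≤-refl

  pairDistSum-lower : ∀ s {m} (g : Fin m → Fin t) →
    let A = ∑[ i < m ] moved s (g i); B = ∑[ i < m ] stays s (g i) in
    pairDistSum g ≤ (A * B + B * A) + pairDistSum (lower s ∘ g)
  pairDistSum-lower s {m} g = begin
    pairDistSum g
      ≤⟨ ∑∑-mono-≤ (λ i j → D-lower s (g i) (g j)) ⟩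
    ∑[ i < m ] ∑[ j < m ] ((c i * u j + u i * c j) + D (g′ i) (g′ j))
      ≡⟨ ∑∑-distrib-+ (λ i j → c i * u j + u i * c j) _ ⟩
    ∑[ i < m ] ∑[ j < m ] (c i * u j + u i * c j) + pairDistSum g′
      ≡⟨ cong (_+ pairDistSum g′) (∑∑-distrib-+ (λ i j → c i * u j) _) ⟩
    (∑[ i < m ] ∑[ j < m ] (c i * u j) + ∑[ i < m ] ∑[ j < m ] (u i * c j)) + pairDistSum g′
      ≡⟨ cong (_+ pairDistSum g′) (cong₂ _+_ (∑∑-product c u) (∑∑-product u c)) ⟩
    (sum c * sum u + sum u * sum c) + pairDistSum g′ ∎
    where
    open ≤-Reasoning
    c u : Fin m → ℕ
    c i = moved s (g i)
    u i = stays s (g i)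
    g′ = lower s ∘ g

  2*pairDistSum≤ : ∀ s {m} (g : Fin m → Fin t) → (∀ i → toℕ (g i) ≤ s) →
                   2 * pairDistSum g ≤ s * (m * m)
  2*pairDistSum≤ zero {m} g g≤0 = ≤-reflexive (cong (2 *_) (begin
    pairDistSum g                 ≡⟨ sum-cong-≗ (λ i → sum-cong-≗ (λ j → D[gi,gj]≡0 i j)) ⟩
    ∑[ i < m ] ∑[ j < m ] 0       ≡⟨ sum-cong-≗ {m} (λ _ → sum-replicate-zero m) ⟩
    ∑[ i < m ] 0                  ≡⟨ sum-replicate-zero m ⟩
    0                             ∎))
    where
    open ≡-Reasoning
    D[gi,gj]≡0 : ∀ i j → D (g i) (g j) ≡ 0
    D[gi,gj]≡0 i j = trans (cong (D (g i)) (toℕ-injective (trans (n≤0⇒n≡0 (g≤0 j)) (sym (n≤0⇒n≡0 (g≤0 i))))))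
                           (D[x,x]≡0 (g i))
  2*pairDistSum≤ (suc s) {m} g g≤1+s = begin
    2 * pairDistSum g                          ≤⟨ *-monoʳ-≤ 2 (pairDistSum-lower s g) ⟩
    2 * ((A * B + B * A) + pairDistSum g′)     ≡⟨ *-distribˡ-+ 2 (A * B + B * A) _ ⟩
    2 * (A * B + B * A) + 2 * pairDistSum g′  ≤⟨ +-mono-≤ (2*[m*n+n*m]≤[m+n]*[m+n] A B)
                                                    (2*pairDistSum≤ s g′ (λ i → toℕ-lower s (g i) (g≤1+s i))) ⟩
    (A + B) * (A + B) + s * (m * m)            ≡⟨ cong (λ n → n * n + s * (m * m)) A+B≡m ⟩
    m * m + s * (m * m)                        ∎
    where
    open ≤-Reasoning
    g′ = lower s ∘ g
    A = ∑[ i < m ] moved s (g i)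
    B = ∑[ i < m ] stays s (g i)
    A+B≡m : A + B ≡ m
    A+B≡m = begin-equality
      A + B                                     ≡⟨ ∑-distrib-+ (λ i → moved s (g i)) _ ⟨
      ∑[ i < m ] (moved s (g i) + stays s (g i)) ≡⟨ sum-cong-≗ (λ i → moved+stays≡1 s (g i)) ⟩
      ∑[ i < m ] 1                              ≡⟨ sum-const m 1 ⟩
      m * 1                                     ≡⟨ *-identityʳ m ⟩
      m                                         ∎

module AttachedTree {t b : ℕ} (H : Tree t) (att : Fin b → Fin t)
  (d : Fin t ⊎ Fin b → Fin t ⊎ Fin b → ℕ)
  (isDistance : ∀ u v → IsDistance (AttachAdj H att) u v (d u v))
  where

  open Distance d isDistance

  base : Fin t ⊎ Fin b → Fin t
  base (inj₁ x) = x
  base (inj₂ j) = att j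

  pendant : Fin t ⊎ Fin b → ℕ
  pendant (inj₁ _) = 0
  pendant (inj₂ _) = 1

  D : Fin t → Fin t → ℕ
  D x y = d (inj₁ x) (inj₁ y)

  d≤pendant+D : ∀ u v → d u v ≤ (pendant u + pendant v) + D (base u) (base v)
  d≤pendant+D (inj₁ x) (inj₁ y) = ≤-refl
  d≤pendant+D (inj₁ x) (inj₂ j) = adjacentʳ refl (inj₁ x)
  d≤pendant+D (inj₂ j) (inj₁ y) = adjacentˡ refl (inj₁ y)
  d≤pendant+D (inj₂ i) (inj₂ j) =
    ≤-trans (adjacentˡ refl (inj₂ j)) (s≤s (adjacentʳ refl (inj₁ (att i))))

  open PairDistanceSum H D (λ x → d[u,u]≡0 (inj₁ x))
    (λ x x>0 y → adjacentˡ (inj₁ (x>0 , refl)) (inj₁ y))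
    (λ x x>0 y → adjacentʳ (inj₂ (x>0 , refl)) (inj₁ y))

  ∑pendant≡b : ∑[ i < t + b ] pendant (splitAt t i) ≡ b
  ∑pendant≡b = begin
    sum (pendant ∘ splitAt t)        ≡⟨ sum-splitAt t pendant ⟩
    ∑[ x < t ] 0 + ∑[ j < b ] 1      ≡⟨ cong₂ _+_ (sum-replicate-zero t) (sum-const b 1) ⟩
    b * 1                            ≡⟨ *-identityʳ b ⟩
    b                                ∎
    where open ≡-Reasoning

  2*OrderedDistSum≤ : let N = t + b in
    2 * OrderedDistSum t b d ≤ 4 * (b * N) + pred t * (N * N)
  2*OrderedDistSum≤ = begin
    2 * OrderedDistSum t b d
      ≡⟨ cong (2 *_) (OrderedDistSum≡∑∑ t b d) ⟩
    2 * ∑[ i < N ] ∑[ j < N ] d (σ i) (σ j)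
      ≤⟨ *-monoʳ-≤ 2 (∑∑-mono-≤ (λ i j → d≤pendant+D (σ i) (σ j))) ⟩
    2 * ∑[ i < N ] ∑[ j < N ] ((p i + p j) + D (g i) (g j))
      ≡⟨ cong (2 *_) (∑∑-distrib-+ (λ i j → p i + p j) _) ⟩
    2 * (∑[ i < N ] ∑[ j < N ] (p i + p j) + pairDistSum g)
      ≡⟨ cong (λ x → 2 * (x + pairDistSum g)) (∑∑-separable p p) ⟩
    2 * ((N * sum p + N * sum p) + pairDistSum g)
      ≡⟨ cong (λ x → 2 * ((N * x + N * x) + pairDistSum g)) ∑pendant≡b ⟩
    2 * ((N * b + N * b) + pairDistSum g)
      ≡⟨ regroup N b (pairDistSum g) ⟩
    4 * (b * N) + 2 * pairDistSum g
      ≤⟨ +-monoʳ-≤ (4 * (b * N)) (2*pairDistSum≤ (pred t) g (λ i → <⇒≤pred (toℕ<n (g i)))) ⟩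
    4 * (b * N) + pred t * (N * N) ∎
    where
    open ≤-Reasoning
    N = t + b
    σ : Fin N → Fin t ⊎ Fin b
    σ = splitAt t
    p : Fin N → ℕ
    p = pendant ∘ σ
    g : Fin N → Fin t
    g = base ∘ σ
    regroup : ∀ N b S → 2 * ((N * b + N * b) + S) ≡ 4 * (b * N) + 2 * S
    regroup = solve-∀

2*[nC2]+n≡n*n : ∀ n → 2 * (n C 2) + n ≡ n * n
2*[nC2]+n≡n*n zero    = refl
2*[nC2]+n≡n*n (suc n) = begin
  2 * (suc n C 2) + suc n         ≡⟨ cong (λ c → 2 * c + suc n) (nCk+nC[k+1]≡[n+1]C[k+1] n 1) ⟨
  2 * (n C 1 + n C 2) + suc n     ≡⟨ cong (λ c → 2 * (c + n C 2) + suc n) (nC1≡n n) ⟩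
  2 * (n + n C 2) + suc n         ≡⟨ regroup n (n C 2) ⟩
  (2 * (n C 2) + n) + suc (n + n) ≡⟨ cong (_+ suc (n + n)) (2*[nC2]+n≡n*n n) ⟩
  n * n + suc (n + n)             ≡⟨ square n ⟩
  suc n * suc n                   ∎
  where
  open ≡-Reasoning
  regroup : ∀ n c → 2 * (n + c) + suc n ≡ (2 * c + n) + suc (n + n)
  regroup = solve-∀
  square : ∀ n → n * n + suc (n + n) ≡ suc n * suc n
  square = solve-∀

pendant-arith : ∀ t b → let a = 2 + t; N = a + b in
  4 * (b * N) + suc t * (N * N) < (a + 3) * (2 * (N C 2))
pendant-arith t b = begin-strict
  4 * (b * N) + suc t * (N * N)                   <⟨ m<m+n _ z<s ⟩
  4 * (b * N) + suc t * (N * N) + (3 + 3 * t) * N ≡⟨ +-cancelʳ-≡ ((a + 3) * N) _ _ expand ⟩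
  (a + 3) * (2 * (N C 2))                         ∎
  where
  open ≤-Reasoning
  a = 2 + t
  N = a + b
  polynomial : ∀ t b → let a = 2 + t; N = a + b in
    4 * (b * N) + suc t * (N * N) + (3 + 3 * t) * N + (a + 3) * N ≡ (a + 3) * (N * N)
  polynomial = solve-∀
  expand : 4 * (b * N) + suc t * (N * N) + (3 + 3 * t) * N + (a + 3) * N
         ≡ (a + 3) * (2 * (N C 2)) + (a + 3) * N
  expand = begin-equality
    4 * (b * N) + suc t * (N * N) + (3 + 3 * t) * N + (a + 3) * N ≡⟨ polynomial t b ⟩
    (a + 3) * (N * N)                         ≡⟨ cong ((a + 3) *_) (2*[nC2]+n≡n*n N) ⟨
    (a + 3) * (2 * (N C 2) + N)               ≡⟨ *-distribˡ-+ (a + 3) (2 * (N C 2)) N ⟩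
    (a + 3) * (2 * (N C 2)) + (a + 3) * N     ∎

t≤2k∸2⇒t+3≤2k+1 : ∀ {k t} → 2 ≤ k → t ≤ 2 * k ∸ 2 → t + 3 ≤ 2 * k + 1
t≤2k∸2⇒t+3≤2k+1 {k} {t} 2≤k t≤2k∸2 = begin
  t + 3       ≡⟨ +-assoc t 2 1 ⟨
  t + 2 + 1   ≤⟨ +-monoˡ-≤ 1 (m≤o∸n⇒m+n≤o t (≤-trans 2≤k (m≤m+n k _)) t≤2k∸2) ⟩
  2 * k + 1   ∎
  where open ≤-Reasoning

lemma5p1 : (k t n : ℕ) → 2 ≤ k → t ≤ 2 * k ∸ 2 → 2 ≤ t → t ≤ n ∸ 2 →
    (H : Tree t) (att : Fin (n ∸ t) → Fin t)
    (d : Fin t ⊎ Fin (n ∸ t) → Fin t ⊎ Fin (n ∸ t) → ℕ) →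
    ((u v : Fin t ⊎ Fin (n ∸ t)) → IsDistance (AttachAdj H att) u v (d u v)) →
    OrderedDistSum t (n ∸ t) d < (2 * k + 1) * (n C 2)
lemma5p1 k t@(suc (suc s)) n 2≤k t≤2k∸2 (s≤s (s≤s z≤n)) t≤n∸2 H att d isDistance =
  *-cancelˡ-< 2 _ _ (begin-strict
    2 * OrderedDistSum t b d        ≤⟨ 2*OrderedDistSum≤ ⟩
    4 * (b * N) + suc s * (N * N)   <⟨ pendant-arith s b ⟩
    (t + 3) * (2 * (N C 2))         ≤⟨ *-monoˡ-≤ (2 * (N C 2)) (t≤2k∸2⇒t+3≤2k+1 2≤k t≤2k∸2) ⟩
    (2 * k + 1) * (2 * (N C 2))     ≡⟨ cong (λ m → (2 * k + 1) * (2 * (m C 2))) N≡n ⟩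
    (2 * k + 1) * (2 * (n C 2))     ≡⟨ x∙yz≈y∙xz (2 * k + 1) 2 (n C 2) ⟩
    2 * ((2 * k + 1) * (n C 2))     ∎)
  where
  open AttachedTree H att d isDistance using (2*OrderedDistSum≤)
  open ≤-Reasoning
  b = n ∸ t
  N = t + b
  N≡n : N ≡ n
  N≡n = m+[n∸m]≡n (≤-trans t≤n∸2 (m∸n≤m n 2))
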